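{- Let $\mathcal{F}=\langle X,R\rangle$ be a Kripke frame ($X$ a nonempty set, $R\subseteq X\times X$). Then $R$ is collusive if and only if $\mathcal{F}\models \Diamond^{\rightarrow}\Diamond^{\leftarrow}\Box^{\rightarrow}A\Rightarrow\Box^{\rightarrow}A$ for every formula $A$.
   Context: $R$ is collusive iff $\forall x,y,z,w\in X\,\big((xRy\wedge xRz\wedge wRy)\Rightarrow wRz\big)$. Formulas are built from propositional atoms with classical connectives and modalities $\Box^{\rightarrow},\Box^{\leftarrow}$, with duals $\Diamond^{\rightarrow}=\neg\Box^{\rightarrow}\neg$, $\Diamond^{\leftarrow}=\neg\Box^{\leftarrow}\neg$. In a model $\mathcal{M}=\langle X,R,V\rangle$ (with $V$ a valuation of atoms), $\mathcal{M},x\models\Box^{\rightarrow}\phi$ iff $\mathcal{M},x'\models\phi$ for all $x'$ with $xRx'$; $\mathcal{M},x\models\Box^{\leftarrow}\phi$ iff $\mathcal{M},x'\models\phi$ for all $x'$ with $x'Rx$; other connectives are classical. $\mathcal{F}\models\phi$ iff $\langle X,R,V\rangle,x\models\phi$ for every valuation $V$ and every $x\in X$. -}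

module Defs where

open import Data.Nat using (ℕ)
open import Data.Product using (_×_)
open import Data.Sum using (_⊎_)
open import Data.Empty using (⊥)
open import Relation.Nullary using (¬_)

record Frame : Set₁ where
  field
    X : Set
    R : X → X → Set

Collusive : {X : Set} → (X → X → Set) → Set
Collusive {X} R = ∀ (x y z w : X) → R x y → R x z → R w y → R w z

data Formula : Set where
  atom  : ℕ → Formula
  ⊥′    : Formula
  ¬′_   : Formula → Formula
  _∧′_  : Formula → Formula → Formula
  _∨′_  : Formula → Formula → Formula
  _⇒′_  : Formula → Formula → Formula
  □→    : Formula → Formula
  □←    : Formula → Formula

◇→ : Formula → Formula
◇→ φ = ¬′ (□→ (¬′ φ))

◇← : Formula → Formula
◇← φ = ¬′ (□← (¬′ φ))

_,_,_⊨_ : {X : Set} → (X → X → Set) → (ℕ → X → Set) → X → Formula → Set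
R , V , x ⊨ atom p  = V p x
R , V , x ⊨ ⊥′      = ⊥
R , V , x ⊨ (¬′ φ)  = ¬ (R , V , x ⊨ φ)
R , V , x ⊨ (φ ∧′ ψ) = (R , V , x ⊨ φ) × (R , V , x ⊨ ψ)
R , V , x ⊨ (φ ∨′ ψ) = (R , V , x ⊨ φ) ⊎ (R , V , x ⊨ ψ)
R , V , x ⊨ (φ ⇒′ ψ) = (R , V , x ⊨ φ) → (R , V , x ⊨ ψ)
R , V , x ⊨ □→ φ    = ∀ x′ → R x x′ → R , V , x′ ⊨ φ
R , V , x ⊨ □← φ    = ∀ x′ → R x′ x → R , V , x′ ⊨ φ

_⊨F_ : Frame → Formula → Set₁
F ⊨F φ = ∀ (V : ℕ → Frame.X F → Set) (x : Frame.X F) → Frame.R F , V , x ⊨ φ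

module Submission where

open import Defs
open import Data.Nat using (ℕ)
open import Level using (0ℓ)
open import Axiom.ExcludedMiddle using (ExcludedMiddle)
open import Function.Bundles using (_⇔_; mk⇔)
open import Relation.Nullary using (¬_)
open import Relation.Nullary.Decidable using (decidable-stable)

-- If x sees y, w sees y and w's successors all satisfy A, then collusiveness makes every
-- successor z of x a successor of w.  Unfolding the diamonds only yields the double negation.
collusive⇒◇→◇←□→⇒□→¬¬ : {X : Set} {R : X → X → Set} → Collusive R →
  ∀ V A x → R , V , x ⊨ ◇→ (◇← (□→ A)) → ∀ z → R x z → ¬ ¬ (R , V , z ⊨ A)
collusive⇒◇→◇←□→⇒□→¬¬ col V A x ◇◇□A z xRz ¬Az =
  ◇◇□A λ y xRy ¬◇□A → ¬◇□A λ w wRy □A → ¬Az (□A z (col x y z w xRy xRz wRy))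

-- The valuation making p true exactly at the successors of w.
◇→◇←□→p⇒□→p⇒collusive : {X : Set} {R : X → X → Set} (p : ℕ) →
  (∀ V x → R , V , x ⊨ (◇→ (◇← (□→ (atom p))) ⇒′ □→ (atom p))) → Collusive R
◇→◇←□→p⇒□→p⇒collusive {R = R} p valid x y z w xRy xRz wRy =
  valid (λ _ u → R w u) x (λ ¬◇□p → ¬◇□p y xRy λ ¬□p → ¬□p w wRy λ _ wRu → wRu) z xRz

mainTheorem14 : ExcludedMiddle 0ℓ → (F : Frame) → Frame.X F →
    Collusive (Frame.R F) ⇔ (∀ (A : Formula) → F ⊨F (◇→ (◇← (□→ A)) ⇒′ □→ A))
mainTheorem14 em F _ = mk⇔
  (λ col A V x ◇◇□A z xRz → decidable-stable em (collusive⇒◇→◇←□→⇒□→¬¬ col V A x ◇◇□A z xRz))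
  (λ valid → ◇→◇←□→p⇒□→p⇒collusive 0 (valid (atom 0)))
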